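{- A composite positive integer $n$ is a Carmichael number if and only if (i) $n$ is square-free and (ii) $\sum_{1\le k\le n-1,\ \gcd(k,n)=1} k^{n-1}\equiv \varphi(n)\pmod{n}$.
   Context: A Carmichael number is a composite positive integer $n$ with $a^{n-1}\equiv 1\pmod n$ for all integers $a$ coprime to $n$. $\varphi$ is Euler's totient function. -}

module Defs where

open import Data.Nat using (ℕ; zero; suc; _+_; _*_; _∸_; _^_)
open import Data.Nat.Divisibility using (_∣_)
open import Data.Nat.Coprimality using (Coprime; coprime?)
open import Data.Nat.Primality using (Composite)
open import Data.List using (List; filter; length; map)
open import Data.Nat.ListAction using (sum)
open import Data.List.Base using (applyUpTo)
open import Data.Product using (_×_; ∃)
open import Relation.Binary.PropositionalEquality using (_≡_)

infix 4 _≡_[mod_]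
_≡_[mod_] : ℕ → ℕ → ℕ → Set
a ≡ b [mod m ] = ∃ λ x → ∃ λ y → a + x * m ≡ b + y * m

Carmichael : ℕ → Set
Carmichael n = Composite n × (∀ a → Coprime a n → a ^ (n ∸ 1) ≡ 1 [mod n ])

SquareFree : ℕ → Set
SquareFree n = ∀ d → d * d ∣ n → d ≡ 1

oneTo : ℕ → List ℕ
oneTo m = applyUpTo suc m

coprimeUpTo : ℕ → ℕ → List ℕ
coprimeUpTo m n = filter (λ k → coprime? k n) (oneTo m)

φ : ℕ → ℕ
φ n = length (coprimeUpTo n n)

powerSum : ℕ → ℕ
powerSum n = sum (map (λ k → k ^ (n ∸ 1)) (coprimeUpTo (n ∸ 1) n))

-- Forward: if d * d ∣ n with d > 1, write n = d * u; then n ∣ u * u, so (1 + u) ^ (n - 1) ≡ 1 + (n - 1) u,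
-- and the Carmichael condition forces d ∣ n - 1, hence d = 1. Each of the φ(n) terms of the power sum is ≡ 1.
--
-- Backward: multiplication by a unit a permutes the reduced residues, so a ^ (n - 1) * S ≡ S for the power
-- sum S ≡ φ(n); it remains to see that φ(n) is a unit. If a prime q ∣ n does not divide φ(n), every nonzero
-- residue modulo q lifts to a unit modulo n, so x ^ (n - 1) ≡ 1 (mod q) for all x ≢ 0, whence q - 1 ∣ n - 1
-- (via the vanishing of ∑ x ^ r modulo q for 0 < r < q - 1, instead of a primitive root). If a prime p divides
-- both n and φ(n) = ∏ (q - 1), then p ∣ q - 1 for a prime q ∣ n; as p ∤ n - 1, also q ∣ φ(n), and q > p.
-- Such an increasing chain of primes dividing n cannot exist.
module Submission where

open import Defs

open import Data.Empty using (⊥)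
open import Data.Fin using (toℕ)
open import Data.Nat
open import Data.Nat.Properties
open import Data.Nat.DivMod
open import Data.Nat.Divisibility
open import Data.Nat.GCD using (module Bézout)
open import Data.Nat.Coprimality using (Coprime; coprime?; coprime-divisor; coprime-Bézout; coprime-+; 1-coprimeTo)
  renaming (sym to coprime-sym)
open import Data.Nat.Primality
open import Data.Nat.Primality.Factorisation using (factorise)
open import Data.Nat.Combinatorics using (_C_; nCn≡1; nC1≡n; nCk≡nC[n∸k])
open import Data.Nat.Induction using (<-rec)
open import Data.Nat.ListAction using (sum; product)
open import Data.Nat.ListAction.Properties using (sum-↭; product-↭)
open import Data.Nat.Solver using (module +-*-Solver)
open +-*-Solver
open import Data.Product using (∃-syntax; _×_; _,_; proj₁; proj₂)
open import Data.Sum using (_⊎_; inj₁; inj₂; [_,_]′)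
open import Data.List using (List; []; _∷_; _++_; [_]; length; filter; applyUpTo; map)
open import Data.List.Properties using (filter-++; length-++; filter-none; filter-reject; applyUpTo-∷ʳ; map-∘)
open import Data.List.Relation.Unary.All as All using (All)
open import Data.List.Relation.Unary.All.Properties using (applyUpTo⁺₁)
open import Data.List.Relation.Unary.Any using (here; there)
open import Data.List.Relation.Unary.AllPairs using ([]; _∷_)
open import Data.List.Relation.Unary.Unique.Propositional using (Unique)
import Data.List.Relation.Unary.Unique.Propositional.Properties as Unique
open import Data.List.Membership.Propositional using (_∈_)
open import Data.List.Membership.Propositional.Properties
  using (∈-map⁺; ∈-map⁻; ∈-filter⁺; ∈-filter⁻; ∈-applyUpTo⁺; ∈-applyUpTo⁻)
open import Data.List.Membership.Propositional.Properties.WithK using (unique∧set⇒bag)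
open import Data.List.Relation.Binary.BagAndSetEquality using (∼bag⇒↭)
open import Data.List.Relation.Binary.Permutation.Propositional using (_↭_)
import Data.List.Relation.Binary.Permutation.Propositional.Properties as ↭
open import Algebra.Properties.CommutativeSemiring.Binomial +-*-commutativeSemiring as Binomial
  using (binomialExpansion)
import Algebra.Properties.Semiring.Exp +-*-semiring as Semiring
import Algebra.Properties.Monoid.Mult +-0-monoid as Multiple
import Algebra.Properties.Monoid.Sum +-0-monoid as Sum
open import Function.Base using (_∘_)
open import Function.Bundles using (_⇔_; mk⇔; Equivalence)
open import Level using (0ℓ)
open import Relation.Nullary using (¬_; yes; no; contradiction)
open import Relation.Unary using (Pred; Decidable)
open import Relation.Unary.Properties using (_∩?_; ∁?)
open import Relation.Binary.PropositionalEquality hiding ([_])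

-- Congruences as equal remainders

module _ {n : ℕ} .{{_ : NonZero n}} where

  %-cong-+ : ∀ {a b c d} → a % n ≡ b % n → c % n ≡ d % n → (a + c) % n ≡ (b + d) % n
  %-cong-+ {a} {b} {c} {d} a≡b c≡d = begin
    (a + c) % n         ≡⟨ %-distribˡ-+ a c n ⟩
    (a % n + c % n) % n ≡⟨ cong₂ (λ x y → (x + y) % n) a≡b c≡d ⟩
    (b % n + d % n) % n ≡⟨ %-distribˡ-+ b d n ⟨
    (b + d) % n         ∎
    where open ≡-Reasoning

  %-cong-* : ∀ {a b c d} → a % n ≡ b % n → c % n ≡ d % n → (a * c) % n ≡ (b * d) % n
  %-cong-* {a} {b} {c} {d} a≡b c≡d = begin
    (a * c) % n           ≡⟨ %-distribˡ-* a c n ⟩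
    (a % n * (c % n)) % n ≡⟨ cong₂ (λ x y → (x * y) % n) a≡b c≡d ⟩
    (b % n * (d % n)) % n ≡⟨ %-distribˡ-* b d n ⟨
    (b * d) % n           ∎
    where open ≡-Reasoning

  %-cong-^ : ∀ {a b} k → a % n ≡ b % n → a ^ k % n ≡ b ^ k % n
  %-cong-^ zero    a≡b = refl
  %-cong-^ (suc k) a≡b = %-cong-* a≡b (%-cong-^ k a≡b)

  %-cong-*ˡ : ∀ c {a b} → a % n ≡ b % n → (c * a) % n ≡ (c * b) % n
  %-cong-*ˡ c = %-cong-* {c} refl

  %-cong-*ʳ : ∀ c {a b} → a % n ≡ b % n → (a * c) % n ≡ (b * c) % n
  %-cong-*ʳ c {a} {b} a≡b = %-cong-* {a} {b} {c} a≡b refl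

  %≡%⇒∣∸ : ∀ {a b} → a % n ≡ b % n → n ∣ a ∸ b
  %≡%⇒∣∸ {a} {b} a≡b = divides (a / n ∸ b / n) (begin
    a ∸ b                                     ≡⟨ cong₂ _∸_ (m≡m%n+[m/n]*n a n) (m≡m%n+[m/n]*n b n) ⟩
    (a % n + a / n * n) ∸ (b % n + b / n * n) ≡⟨ cong (λ x → (x + a / n * n) ∸ (b % n + b / n * n)) a≡b ⟩
    (b % n + a / n * n) ∸ (b % n + b / n * n) ≡⟨ [m+n]∸[m+o]≡n∸o (b % n) (a / n * n) (b / n * n) ⟩
    a / n * n ∸ b / n * n                     ≡⟨ *-distribʳ-∸ n (a / n) (b / n) ⟨
    (a / n ∸ b / n) * n                       ∎)
    where open ≡-Reasoning

  %≡%⇒≡[mod] : ∀ {a b} → a % n ≡ b % n → a ≡ b [mod n ]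
  %≡%⇒≡[mod] {a} {b} a≡b = b / n , a / n , (begin
    a + b / n * n                 ≡⟨ cong (_+ b / n * n) (m≡m%n+[m/n]*n a n) ⟩
    a % n + a / n * n + b / n * n ≡⟨ cong (λ x → x + a / n * n + b / n * n) a≡b ⟩
    b % n + a / n * n + b / n * n ≡⟨ solve 3 (λ r x y → r :+ x :+ y := r :+ y :+ x) refl (b % n) (a / n * n) (b / n * n) ⟩
    b % n + b / n * n + a / n * n ≡⟨ cong (_+ a / n * n) (m≡m%n+[m/n]*n b n) ⟨
    b + a / n * n                 ∎)
    where open ≡-Reasoning

  ≡[mod]⇒%≡% : ∀ {a b} → a ≡ b [mod n ] → a % n ≡ b % n
  ≡[mod]⇒%≡% {a} {b} (x , y , eq) = begin
    a % n           ≡⟨ [m+kn]%n≡m%n a x n ⟨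
    (a + x * n) % n ≡⟨ cong (_% n) eq ⟩
    (b + y * n) % n ≡⟨ [m+kn]%n≡m%n b y n ⟩
    b % n           ∎
    where open ≡-Reasoning

%-inverse : ∀ {c} n .{{_ : NonZero n}} → Coprime c n → ∃[ c⁻¹ ] c⁻¹ * c % n ≡ 1 % n
%-inverse {c} n@(suc e) c⊥n with coprime-Bézout c⊥n
... | Bézout.+- x y eq = x , (begin
  x * c % n       ≡⟨ cong (_% n) eq ⟨
  (1 + y * n) % n ≡⟨ [m+kn]%n≡m%n 1 y n ⟩
  1 % n           ∎)
  where open ≡-Reasoning
... | Bézout.-+ x y eq = e * x , (begin
  e * x * c % n             ≡⟨ [m+kn]%n≡m%n (e * x * c) 1 n ⟨
  (e * x * c + 1 * n) % n   ≡⟨ cong (_% n) (solve 3 (λ e x c → e :* x :* c :+ con 1 :* (con 1 :+ e)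
                                                   := e :* (con 1 :+ x :* c) :+ con 1) refl e x c) ⟩
  (e * (1 + x * c) + 1) % n ≡⟨ cong (λ z → (e * z + 1) % n) eq ⟩
  (e * (y * n) + 1) % n     ≡⟨ cong (_% n) (trans (+-comm _ 1) (cong (1 +_) (sym (*-assoc e y n)))) ⟩
  (1 + e * y * n) % n       ≡⟨ [m+kn]%n≡m%n 1 (e * y) n ⟩
  1 % n                     ∎)
  where open ≡-Reasoning

%≡%-cancelʳ : ∀ {n} .{{_ : NonZero n}} {a b c} → Coprime c n → a * c % n ≡ b * c % n → a % n ≡ b % n
%≡%-cancelʳ {n} {a} {b} {c} c⊥n ac≡bc with %-inverse n c⊥n
... | c⁻¹ , c⁻¹c≡1 = begin
  a % n                 ≡⟨ cong (_% n) (*-identityʳ a) ⟨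
  a * 1 % n             ≡⟨ %-cong-*ˡ a c⁻¹c≡1 ⟨
  a * (c⁻¹ * c) % n     ≡⟨ cong (_% n) (solve 3 (λ a u c → a :* (u :* c) := a :* c :* u) refl a c⁻¹ c) ⟩
  a * c * c⁻¹ % n       ≡⟨ %-cong-* ac≡bc refl ⟩
  b * c * c⁻¹ % n       ≡⟨ cong (_% n) (solve 3 (λ a u c → a :* (u :* c) := a :* c :* u) refl b c⁻¹ c) ⟨
  b * (c⁻¹ * c) % n     ≡⟨ %-cong-*ˡ b c⁻¹c≡1 ⟩
  b * 1 % n             ≡⟨ cong (_% n) (*-identityʳ b) ⟩
  b % n                 ∎
  where open ≡-Reasoning

%≡%-∣ : ∀ {m n} .{{_ : NonZero m}} .{{_ : NonZero n}} → m ∣ n → ∀ {a b} → a % n ≡ b % n → a % m ≡ b % m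
%≡%-∣ {m} {n} m∣n {a} {b} a≡b = begin
  a % m     ≡⟨ m∣n⇒o%n%m≡o%m m n a m∣n ⟨
  a % n % m ≡⟨ cong (_% m) a≡b ⟩
  b % n % m ≡⟨ m∣n⇒o%n%m≡o%m m n b m∣n ⟩
  b % m     ∎
  where open ≡-Reasoning

∣1+n∣n⇒∣1 : ∀ {d n} → d ∣ 1 + n → d ∣ n → d ∣ 1
∣1+n∣n⇒∣1 {d} {n} d∣1+n = ∣m+n∣m⇒∣n (subst (d ∣_) (+-comm 1 n) d∣1+n)

[m*n]^k≡m^k*n^k : ∀ m n k → (m * n) ^ k ≡ m ^ k * n ^ k
[m*n]^k≡m^k*n^k m n zero    = refl
[m*n]^k≡m^k*n^k m n (suc k) = trans (cong (m * n *_) ([m*n]^k≡m^k*n^k m n k))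
  (solve 4 (λ m n a b → m :* n :* (a :* b) := m :* a :* (n :* b)) refl m n (m ^ k) (n ^ k))

coprime-∣ʳ : ∀ {k m n} → m ∣ n → Coprime k n → Coprime k m
coprime-∣ʳ m∣n k⊥n (d∣k , d∣m) = k⊥n (d∣k , ∣-trans d∣m m∣n)

coprime-*ʳ : ∀ {k m n} → Coprime k m → Coprime k n → Coprime k (m * n)
coprime-*ʳ {k} {m} k⊥m k⊥n {d} (d∣k , d∣mn) = k⊥n (d∣k , coprime-divisor d⊥m d∣mn)
  where
  d⊥m : Coprime d m
  d⊥m (e∣d , e∣m) = k⊥m (∣-trans e∣d d∣k , e∣m)

coprime-*ˡ : ∀ {a b n} → Coprime a n → Coprime b n → Coprime (a * b) n
coprime-*ˡ a⊥n b⊥n = coprime-sym (coprime-*ʳ (coprime-sym a⊥n) (coprime-sym b⊥n))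

coprime-*ˡ⁻ : ∀ {a b n} → Coprime (a * b) n → Coprime b n
coprime-*ˡ⁻ {a} ab⊥n (d∣b , d∣n) = ab⊥n (∣n⇒∣m*n a d∣b , d∣n)

coprime-+⁻ : ∀ {k m} → Coprime (m + k) m → Coprime k m
coprime-+⁻ m+k⊥m (d∣k , d∣m) = m+k⊥m (∣m∣n⇒∣m+n d∣m d∣k , d∣m)

coprime-% : ∀ {a n} .{{_ : NonZero n}} → Coprime a n → Coprime (a % n) n
coprime-% a⊥n (d∣a%n , d∣n) = a⊥n (∣n∣m%n⇒∣m d∣n d∣a%n , d∣n)

prime∤⇒coprime : ∀ {p k} → Prime p → ¬ p ∣ k → Coprime p k
prime∤⇒coprime p-prime p∤k (d∣p , d∣k) with prime⇒irreducible p-prime d∣p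
... | inj₁ d≡1    = d≡1
... | inj₂ refl   = contradiction d∣k p∤k

prime∤1 : ∀ {p} → Prime p → ¬ p ∣ 1
prime∤1 p-prime p∣1 = nonTrivial⇒≢1 {{prime⇒nonTrivial p-prime}} (∣1⇒≡1 p∣1)

coprime⇒prime∤ : ∀ {p k} → Prime p → Coprime p k → ¬ p ∣ k
coprime⇒prime∤ p-prime p⊥k p∣k = nonTrivial⇒≢1 {{prime⇒nonTrivial p-prime}} (p⊥k (∣-refl , p∣k))

-- Counting, and the totient of q * m

count : {P : Pred ℕ 0ℓ} → Decidable P → List ℕ → ℕ
count P? xs = length (filter P? xs)

module _ {P : Pred ℕ 0ℓ} (P? : Decidable P) where

  count-++ : ∀ xs ys → count P? (xs ++ ys) ≡ count P? xs + count P? ys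
  count-++ xs ys = trans (cong length (filter-++ P? xs ys)) (length-++ (filter P? xs))

  count-split : ∀ {Q : Pred ℕ 0ℓ} (Q? : Decidable Q) xs →
                count P? xs ≡ count (P? ∩? Q?) xs + count (P? ∩? ∁? Q?) xs
  count-split Q? []       = refl
  count-split Q? (x ∷ xs) with P? x | Q? x
  ... | yes _ | yes _ = cong suc (count-split Q? xs)
  ... | yes _ | no  _ = trans (cong suc (count-split Q? xs)) (sym (+-suc _ _))
  ... | no  _ | _     = count-split Q? xs

  count-applyUpTo-≐ : ∀ {Q : Pred ℕ 0ℓ} (Q? : Decidable Q) f g n → (∀ i → P (f i) ⇔ Q (g i)) →
                      count P? (applyUpTo f n) ≡ count Q? (applyUpTo g n)
  count-applyUpTo-≐ Q? f g zero    P⇔Q = refl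
  count-applyUpTo-≐ Q? f g (suc n) P⇔Q with P? (f 0) | Q? (g 0)
  ... | yes _  | yes _  = cong suc (count-applyUpTo-≐ Q? (f ∘ suc) (g ∘ suc) n (P⇔Q ∘ suc))
  ... | no  _  | no  _  = count-applyUpTo-≐ Q? (f ∘ suc) (g ∘ suc) n (P⇔Q ∘ suc)
  ... | yes Pf | no ¬Qg = contradiction (Equivalence.to (P⇔Q 0) Pf) ¬Qg
  ... | no ¬Pf | yes Qg = contradiction (Equivalence.from (P⇔Q 0) Qg) ¬Pf

applyUpTo-+ : ∀ {A : Set} (f : ℕ → A) a b → applyUpTo f (a + b) ≡ applyUpTo f a ++ applyUpTo (λ i → f (a + i)) b
applyUpTo-+ f zero    b = refl
applyUpTo-+ f (suc a) b = cong (f 0 ∷_) (applyUpTo-+ (f ∘ suc) a b)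

module _ {P : Pred ℕ 0ℓ} (P? : Decidable P) (q' : ℕ) where
  private
    q = suc q'

  count-multiples : ∀ j → count (P? ∩? (q ∣?_)) (oneTo (q * j)) ≡ count (P? ∘ (q *_)) (oneTo j)
  count-multiples zero    = cong (count (P? ∩? (q ∣?_)) ∘ oneTo) (*-zeroʳ q)
  count-multiples (suc j) = begin
    count P∣? (oneTo (q * suc j))                              ≡⟨ cong (count P∣? ∘ oneTo) q[1+j]≡qj+q ⟩
    count P∣? (oneTo (q * j + q))                              ≡⟨ cong (count P∣?) (applyUpTo-+ suc (q * j) q) ⟩
    count P∣? (oneTo (q * j) ++ applyUpTo block q)             ≡⟨ count-++ P∣? (oneTo (q * j)) _ ⟩
    count P∣? (oneTo (q * j)) + count P∣? (applyUpTo block q)  ≡⟨ cong₂ _+_ (count-multiples j) count-block ⟩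
    count Pq? (oneTo j) + count Pq? [ suc j ]                  ≡⟨ count-++ Pq? (oneTo j) [ suc j ] ⟨
    count Pq? (oneTo j ++ [ suc j ])                           ≡⟨ cong (count Pq?) (applyUpTo-∷ʳ suc j) ⟩
    count Pq? (oneTo (suc j))                                  ∎
    where
    open ≡-Reasoning
    P∣? = P? ∩? (q ∣?_)
    Pq? = P? ∘ (q *_)
    q[1+j]≡qj+q : q * suc j ≡ q * j + q
    q[1+j]≡qj+q = trans (*-suc q j) (+-comm q (q * j))
    block : ℕ → ℕ
    block i = suc (q * j + i)
    last≡ : block q' ≡ q * suc j
    last≡ = trans (sym (+-suc (q * j) q')) (sym q[1+j]≡qj+q)
    count-block : count P∣? (applyUpTo block q) ≡ count Pq? [ suc j ]
    count-block = begin
      count P∣? (applyUpTo block q)                        ≡⟨ cong (count P∣?) (applyUpTo-∷ʳ block q') ⟨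
      count P∣? (applyUpTo block q' ++ [ block q' ])       ≡⟨ count-++ P∣? (applyUpTo block q') _ ⟩
      count P∣? (applyUpTo block q') + count P∣? [ block q' ]
        ≡⟨ cong (_+ count P∣? [ block q' ]) (cong length (filter-none P∣? (applyUpTo⁺₁ block q' no-multiple))) ⟩
      count P∣? [ block q' ]                               ≡⟨ count-applyUpTo-≐ P∣? Pq? _ _ 1 (λ _ → last-multiple) ⟩
      count Pq? [ suc j ]                                  ∎
      where
      no-multiple : ∀ {i} → i < q' → ¬ (P (block i) × q ∣ block i)
      no-multiple {i} i<q' (_ , q∣block) =
        <⇒≱ (s≤s i<q') (∣⇒≤ (∣m+n∣m⇒∣n (subst (q ∣_) (sym (+-suc (q * j) i)) q∣block) (m∣m*n j)))
      last-multiple : (P (block q') × q ∣ block q') ⇔ P (q * suc j)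
      last-multiple rewrite last≡ = mk⇔ proj₁ (_, m∣m*n (suc j))

coprime-multiple⇔ : ∀ {q m} → Coprime q m → ∀ j → Coprime (q * j) m ⇔ Coprime j m
coprime-multiple⇔ {q} q⊥m j = mk⇔ (coprime-*ˡ⁻ {q}) (coprime-*ˡ q⊥m)

coprime-prime*⇔ : ∀ {q m} → Prime q → ∀ k → (Coprime k m × ¬ q ∣ k) ⇔ Coprime k (q * m)
coprime-prime*⇔ {q} {m} q-prime k = mk⇔ to from
  where
  to : Coprime k m × ¬ q ∣ k → Coprime k (q * m)
  to (k⊥m , q∤k) = coprime-*ʳ (coprime-sym (prime∤⇒coprime q-prime q∤k)) k⊥m
  from : Coprime k (q * m) → Coprime k m × ¬ q ∣ k
  from k⊥qm = coprime-∣ʳ (n∣m*n q) k⊥qm , coprime⇒prime∤ q-prime (coprime-sym (coprime-∣ʳ (m∣m*n m) k⊥qm))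

module _ (m : ℕ) where
  private
    coprime-to-m? : Decidable (λ k → Coprime k m)
    coprime-to-m? k = coprime? k m

  count-coprime-periodic : ∀ j → count coprime-to-m? (oneTo (j * m)) ≡ j * φ m
  count-coprime-periodic zero    = refl
  count-coprime-periodic (suc j) = begin
    count coprime-to-m? (oneTo (m + j * m))                                ≡⟨ cong (count coprime-to-m?) (applyUpTo-+ suc m (j * m)) ⟩
    count coprime-to-m? (oneTo m ++ applyUpTo (λ i → suc (m + i)) (j * m)) ≡⟨ count-++ coprime-to-m? (oneTo m) _ ⟩
    φ m + count coprime-to-m? (applyUpTo (λ i → suc (m + i)) (j * m))
      ≡⟨ cong (φ m +_) (count-applyUpTo-≐ coprime-to-m? coprime-to-m? _ suc (j * m) shift) ⟩
    φ m + count coprime-to-m? (oneTo (j * m))                              ≡⟨ cong (φ m +_) (count-coprime-periodic j) ⟩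
    φ m + j * φ m                                                          ∎
    where
    open ≡-Reasoning
    shift : ∀ i → Coprime (suc (m + i)) m ⇔ Coprime (suc i) m
    shift i rewrite sym (+-suc m i) = mk⇔ coprime-+⁻ coprime-+

  φ[q*m]+φ[m]≡q*φ[m] : ∀ {q} → Prime q → ¬ q ∣ m → φ (q * m) + φ m ≡ q * φ m
  φ[q*m]+φ[m]≡q*φ[m] {q@(suc q')} q-prime q∤m = begin
    φ (q * m) + φ m                                                    ≡⟨ +-comm (φ (q * m)) (φ m) ⟩
    φ m + φ (q * m)                                                    ≡⟨ cong₂ _+_ coprime-multiples coprime-to-qm ⟨
    count (coprime-to-m? ∩? (q ∣?_)) (oneTo (q * m))
      + count (coprime-to-m? ∩? ∁? (q ∣?_)) (oneTo (q * m))            ≡⟨ count-split coprime-to-m? (q ∣?_) (oneTo (q * m)) ⟨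
    count coprime-to-m? (oneTo (q * m))                                ≡⟨ count-coprime-periodic q ⟩
    q * φ m                                                            ∎
    where
    open ≡-Reasoning
    q⊥m = prime∤⇒coprime q-prime q∤m
    coprime-to-qm : count (coprime-to-m? ∩? ∁? (q ∣?_)) (oneTo (q * m)) ≡ φ (q * m)
    coprime-to-qm = count-applyUpTo-≐ _ (λ k → coprime? k (q * m)) suc suc (q * m) (coprime-prime*⇔ q-prime ∘ suc)
    coprime-multiples : count (coprime-to-m? ∩? (q ∣?_)) (oneTo (q * m)) ≡ φ m
    coprime-multiples = trans (count-multiples coprime-to-m? q' m)
                              (count-applyUpTo-≐ _ coprime-to-m? suc suc m (coprime-multiple⇔ q⊥m ∘ suc))

φ[q*m]≡[q∸1]*φ[m] : ∀ {q m} → Prime q → ¬ q ∣ m → φ (q * m) ≡ (q ∸ 1) * φ m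
φ[q*m]≡[q∸1]*φ[m] {q} {m} q-prime q∤m = begin
  φ (q * m)               ≡⟨ m+n∸n≡m (φ (q * m)) (φ m) ⟨
  φ (q * m) + φ m ∸ φ m   ≡⟨ cong (_∸ φ m) (φ[q*m]+φ[m]≡q*φ[m] m q-prime q∤m) ⟩
  q * φ m ∸ φ m           ≡⟨ cong (q * φ m ∸_) (*-identityˡ (φ m)) ⟨
  q * φ m ∸ 1 * φ m       ≡⟨ *-distribʳ-∸ (φ m) q 1 ⟨
  (q ∸ 1) * φ m           ∎
  where open ≡-Reasoning

φ[q]≡q∸1 : ∀ {q} → Prime q → φ q ≡ q ∸ 1
φ[q]≡q∸1 {q} q-prime = begin
  φ q             ≡⟨ cong φ (*-identityʳ q) ⟨
  φ (q * 1)       ≡⟨ φ[q*m]≡[q∸1]*φ[m] q-prime (prime∤1 q-prime) ⟩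
  (q ∸ 1) * 1     ≡⟨ *-identityʳ (q ∸ 1) ⟩
  q ∸ 1           ∎
  where open ≡-Reasoning

-- Reduced residues, and Euler's theorem

unique-map⁺ : ∀ {f : ℕ → ℕ} {xs} → (∀ {x y} → x ∈ xs → y ∈ xs → f x ≡ f y → x ≡ y) →
              Unique xs → Unique (map f xs)
unique-map⁺ {f} {[]}     f-inj []              = []
unique-map⁺ {f} {x ∷ xs} f-inj (x∉xs ∷ xs-uniq) =
  All.tabulate fx≢ ∷ unique-map⁺ (λ x∈ y∈ → f-inj (there x∈) (there y∈)) xs-uniq
  where
  fx≢ : ∀ {z} → z ∈ map f xs → f x ≢ z
  fx≢ z∈ fx≡z with ∈-map⁻ f z∈
  ... | y , y∈xs , refl = All.lookup x∉xs y∈xs (f-inj (here refl) (there y∈xs) fx≡z)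

sum-map-% : ∀ {n} .{{_ : NonZero n}} (f g : ℕ → ℕ) xs → (∀ {x} → x ∈ xs → f x % n ≡ g x % n) →
            sum (map f xs) % n ≡ sum (map g xs) % n
sum-map-% f g []       f≡g = refl
sum-map-% f g (x ∷ xs) f≡g = %-cong-+ (f≡g (here refl)) (sum-map-% f g xs (f≡g ∘ there))

product-map-% : ∀ {n} .{{_ : NonZero n}} (f g : ℕ → ℕ) xs → (∀ {x} → x ∈ xs → f x % n ≡ g x % n) →
                product (map f xs) % n ≡ product (map g xs) % n
product-map-% f g []       f≡g = refl
product-map-% f g (x ∷ xs) f≡g = %-cong-* (f≡g (here refl)) (product-map-% f g xs (f≡g ∘ there))

sum-map-*ˡ : ∀ c (f : ℕ → ℕ) xs → sum (map (λ x → c * f x) xs) ≡ c * sum (map f xs)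
sum-map-*ˡ c f []       = sym (*-zeroʳ c)
sum-map-*ˡ c f (x ∷ xs) = trans (cong (c * f x +_) (sum-map-*ˡ c f xs)) (sym (*-distribˡ-+ c (f x) _))

product-map-*ˡ : ∀ c xs → product (map (c *_) xs) ≡ c ^ length xs * product xs
product-map-*ˡ c []       = refl
product-map-*ˡ c (x ∷ xs) = begin
  c * x * product (map (c *_) xs)         ≡⟨ cong (c * x *_) (product-map-*ˡ c xs) ⟩
  c * x * (c ^ length xs * product xs)
    ≡⟨ solve 4 (λ c x d p → c :* x :* (d :* p) := c :* d :* (x :* p)) refl c x (c ^ length xs) (product xs) ⟩
  c * c ^ length xs * (x * product xs)    ∎
  where open ≡-Reasoning

coprime-product : ∀ {n xs} → All (λ x → Coprime x n) xs → Coprime (product xs) n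
coprime-product {n} All.[]              = 1-coprimeTo n
coprime-product     (x⊥n All.∷ xs⊥n) = coprime-*ˡ x⊥n (coprime-product xs⊥n)

sum-map-1 : (xs : List ℕ) → sum (map (λ _ → 1) xs) ≡ length xs
sum-map-1 []       = refl
sum-map-1 (x ∷ xs) = cong suc (sum-map-1 xs)

-- The reduced residues modulo n, so that `powerSum n` is definitionally a sum over `units n`.
units : ℕ → List ℕ
units n = coprimeUpTo (n ∸ 1) n

module _ (e : ℕ) .{{_ : NonZero e}} where
  private
    n = suc e

  n≢1 : n ≢ 1
  n≢1 n≡1 = ≢-nonZero⁻¹ e (suc-injective n≡1)

  ¬coprime[n,n] : ¬ Coprime n n
  ¬coprime[n,n] n⊥n = n≢1 (n⊥n (∣-refl , ∣-refl))

  ∈-units⁻ : ∀ {x} → x ∈ units n → 0 < x × x < n × Coprime x n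
  ∈-units⁻ x∈ with ∈-filter⁻ (λ k → coprime? k n) {xs = oneTo e} x∈
  ... | x∈oneTo , x⊥n with ∈-applyUpTo⁻ suc x∈oneTo
  ... | i , i<e , refl = z<s , s<s i<e , x⊥n

  ∈-units⁺ : ∀ {x} → 0 < x → x < n → Coprime x n → x ∈ units n
  ∈-units⁺ {suc i} _ (s<s i<e) x⊥n = ∈-filter⁺ (λ k → coprime? k n) (∈-applyUpTo⁺ suc i<e) x⊥n

  units-unique : Unique (units n)
  units-unique = Unique.filter⁺ (λ k → coprime? k n) (Unique.applyUpTo⁺₁ suc e (λ i<j _ → <⇒≢ i<j ∘ suc-injective))

  length-units : length (units n) ≡ φ n
  length-units = begin
    length (units n)                                  ≡⟨ +-identityʳ _ ⟨
    length (units n) + 0                              ≡⟨ cong ((length (units n) +_) ∘ length) (filter-reject C? ¬coprime[n,n]) ⟨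
    length (units n) + length (filter C? [ n ])       ≡⟨ length-++ (units n) ⟨
    length (units n ++ filter C? [ n ])               ≡⟨ cong length (filter-++ C? (oneTo e) [ n ]) ⟨
    length (filter C? (oneTo e ++ [ n ]))             ≡⟨ cong (length ∘ filter C?) (applyUpTo-∷ʳ suc e) ⟩
    φ n                                               ∎
    where
    open ≡-Reasoning
    C? = λ k → coprime? k n

  unit-residue-pos : ∀ {z} → Coprime z n → 0 < z % n
  unit-residue-pos {z} z⊥n with z % n in z%n≡0
  ... | zero  = contradiction (z⊥n (m%n≡0⇒n∣m z n z%n≡0 , ∣-refl)) n≢1
  ... | suc _ = z<s

  residue∈units : ∀ {z} → Coprime z n → z % n ∈ units n
  residue∈units {z} z⊥n = ∈-units⁺ (unit-residue-pos z⊥n) (m%n<n z n) (coprime-% z⊥n)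

  units-↭ : ∀ {a} → Coprime a n → map (λ x → a * x % n) (units n) ↭ units n
  units-↭ {a} a⊥n = ∼bag⇒↭ (unique∧set⇒bag (unique-map⁺ ·a-injective units-unique) units-unique
                                            (mk⇔ ·a-into ·a-onto))
    where
    ·a : ℕ → ℕ
    ·a x = a * x % n
    ·a-unit : ∀ {x} → Coprime x n → ·a x ∈ units n
    ·a-unit {x} x⊥n = residue∈units (coprime-*ˡ {a} a⊥n x⊥n)
    ·a-into : ∀ {y} → y ∈ map ·a (units n) → y ∈ units n
    ·a-into y∈ with ∈-map⁻ ·a y∈
    ... | x , x∈ , refl = ·a-unit {x = x} (proj₂ (proj₂ (∈-units⁻ x∈)))
    ·a-injective : ∀ {x y} → x ∈ units n → y ∈ units n → ·a x ≡ ·a y → x ≡ y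
    ·a-injective {x} {y} x∈ y∈ ax≡ay = begin
      x     ≡⟨ m<n⇒m%n≡m (proj₁ (proj₂ (∈-units⁻ x∈))) ⟨
      x % n ≡⟨ %≡%-cancelʳ {a = x} {y} a⊥n (trans (cong (_% n) (*-comm x a)) (trans ax≡ay (cong (_% n) (*-comm a y)))) ⟩
      y % n ≡⟨ m<n⇒m%n≡m (proj₁ (proj₂ (∈-units⁻ y∈))) ⟩
      y     ∎
      where open ≡-Reasoning
    ·a-onto : ∀ {y} → y ∈ units n → y ∈ map ·a (units n)
    ·a-onto {y} y∈ with ∈-units⁻ y∈ | %-inverse n a⊥n
    ... | _ , y<n , y⊥n | a⁻¹ , a⁻¹a≡1 =
      subst (_∈ map ·a (units n)) ·a[a⁻¹y]≡y (∈-map⁺ ·a (residue∈units (coprime-*ˡ {a⁻¹} a⁻¹⊥n y⊥n)))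
      where
      a⁻¹⊥n : Coprime a⁻¹ n
      a⁻¹⊥n {d} (d∣a⁻¹ , d∣n) =
        ∣1⇒≡1 (∣n∣m%n⇒∣m d∣n (subst (d ∣_) a⁻¹a≡1 (%-presˡ-∣ (∣m⇒∣m*n a d∣a⁻¹) d∣n)))
      ·a[a⁻¹y]≡y : ·a (a⁻¹ * y % n) ≡ y
      ·a[a⁻¹y]≡y = begin
        a * (a⁻¹ * y % n) % n ≡⟨ %-cong-*ˡ a (m%n%n≡m%n (a⁻¹ * y) n) ⟩
        a * (a⁻¹ * y) % n     ≡⟨ cong (_% n) (solve 3 (λ a b y → a :* (b :* y) := b :* a :* y) refl a a⁻¹ y) ⟩
        a⁻¹ * a * y % n       ≡⟨ %-cong-*ʳ y {a⁻¹ * a} {1} a⁻¹a≡1 ⟩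
        1 * y % n             ≡⟨ cong (_% n) (*-identityˡ y) ⟩
        y % n                 ≡⟨ m<n⇒m%n≡m y<n ⟩
        y                     ∎
        where open ≡-Reasoning

  sum-map-units-·a : ∀ {a} → Coprime a n → (f : ℕ → ℕ) →
                     sum (map (λ x → f (a * x % n)) (units n)) ≡ sum (map f (units n))
  sum-map-units-·a {a} a⊥n f = trans (cong sum (map-∘ (units n))) (sum-↭ (↭.map⁺ f (units-↭ a⊥n)))

  product-map-units-·a : ∀ {a} → Coprime a n →
                         product (map (λ x → a * x % n) (units n)) ≡ product (units n)
  product-map-units-·a {a} a⊥n = product-↭ (units-↭ a⊥n)

  units-power-sum-invariant : ∀ {a} k → Coprime a n →
    a ^ k * sum (map (_^ k) (units n)) % n ≡ sum (map (_^ k) (units n)) % n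
  units-power-sum-invariant {a} k a⊥n = begin
    a ^ k * sum (map (_^ k) (units n)) % n               ≡⟨ cong (_% n) (sum-map-*ˡ (a ^ k) (_^ k) (units n)) ⟨
    sum (map (λ x → a ^ k * x ^ k) (units n)) % n        ≡⟨ sum-map-% _ _ (units n) (λ {x} _ → reduce x) ⟩
    sum (map (λ x → (a * x % n) ^ k) (units n)) % n      ≡⟨ cong (_% n) (sum-map-units-·a a⊥n (_^ k)) ⟩
    sum (map (_^ k) (units n)) % n                       ∎
    where
    open ≡-Reasoning
    reduce : ∀ x → a ^ k * x ^ k % n ≡ (a * x % n) ^ k % n
    reduce x = trans (cong (_% n) (sym ([m*n]^k≡m^k*n^k a x k))) (%-cong-^ k (sym (m%n%n≡m%n (a * x) n)))

  euler : ∀ {a} → Coprime a n → a ^ φ n % n ≡ 1 % n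
  euler {a} a⊥n = %≡%-cancelʳ {a = a ^ φ n} {1} (coprime-product (All.tabulate (proj₂ ∘ proj₂ ∘ ∈-units⁻))) (begin
    a ^ φ n * product (units n) % n                      ≡⟨ cong (λ k → a ^ k * product (units n) % n) length-units ⟨
    a ^ length (units n) * product (units n) % n         ≡⟨ cong (_% n) (product-map-*ˡ a (units n)) ⟨
    product (map (a *_) (units n)) % n                   ≡⟨ product-map-% _ _ (units n) (λ {x} _ → sym (m%n%n≡m%n (a * x) n)) ⟩
    product (map (λ x → a * x % n) (units n)) % n        ≡⟨ cong (_% n) (product-map-units-·a a⊥n) ⟩
    product (units n) % n                                ≡⟨ cong (_% n) (*-identityˡ (product (units n))) ⟨
    1 * product (units n) % n                            ∎)
    where open ≡-Reasoning

fermat : ∀ {q x} .{{_ : NonZero q}} → Prime q → ¬ q ∣ x → x ^ (q ∸ 1) % q ≡ 1 % q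
fermat {q@(suc (suc k))} {x} q-prime q∤x =
  subst (λ i → x ^ i % q ≡ 1 % q) (φ[q]≡q∸1 q-prime) (euler (suc k) (coprime-sym (prime∤⇒coprime q-prime q∤x)))

-- Power sums modulo a prime

sum< : ℕ → (ℕ → ℕ) → ℕ
sum< zero    f = 0
sum< (suc k) f = f 0 + sum< k (f ∘ suc)

syntax sum< k (λ i → e) = ∑[ i < k ] e

sum<-cong : ∀ k {f g : ℕ → ℕ} → (∀ i → f i ≡ g i) → sum< k f ≡ sum< k g
sum<-cong zero    f≗g = refl
sum<-cong (suc k) f≗g = cong₂ _+_ (f≗g 0) (sum<-cong k (f≗g ∘ suc))

sum<-snoc : ∀ k f → sum< (suc k) f ≡ sum< k f + f k
sum<-snoc zero    f = +-comm (f 0) 0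
sum<-snoc (suc k) f = trans (cong (f 0 +_) (sum<-snoc k (f ∘ suc))) (sym (+-assoc (f 0) _ _))

sum<-telescope : ∀ k f → sum< k (f ∘ suc) + f 0 ≡ sum< k f + f k
sum<-telescope k f = trans (+-comm _ (f 0)) (sum<-snoc k f)

sum<-+ : ∀ k f g → ∑[ i < k ] (f i + g i) ≡ sum< k f + sum< k g
sum<-+ zero    f g = refl
sum<-+ (suc k) f g = trans (cong (f 0 + g 0 +_) (sum<-+ k (f ∘ suc) (g ∘ suc)))
  (solve 4 (λ a b c d → a :+ b :+ (c :+ d) := a :+ c :+ (b :+ d)) refl (f 0) (g 0) (sum< k (f ∘ suc)) (sum< k (g ∘ suc)))

sum<-*ˡ : ∀ k c f → ∑[ i < k ] (c * f i) ≡ c * sum< k f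
sum<-*ˡ zero    c f = sym (*-zeroʳ c)
sum<-*ˡ (suc k) c f = trans (cong (c * f 0 +_) (sum<-*ˡ k c (f ∘ suc))) (sym (*-distribˡ-+ c (f 0) _))

sum<-zero : ∀ k → ∑[ i < k ] 0 ≡ 0
sum<-zero zero    = refl
sum<-zero (suc k) = sum<-zero k

sum<-comm : ∀ k l (f : ℕ → ℕ → ℕ) → ∑[ i < k ] ∑[ j < l ] f i j ≡ ∑[ j < l ] ∑[ i < k ] f i j
sum<-comm zero    l f = sym (sum<-zero l)
sum<-comm (suc k) l f = trans (cong (sum< l (f 0) +_) (sum<-comm k l (f ∘ suc)))
  (sym (sum<-+ l (f 0) (λ j → ∑[ i < k ] f (suc i) j)))

sum<-const : ∀ k c → ∑[ i < k ] c ≡ k * c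
sum<-const zero    c = refl
sum<-const (suc k) c = cong (c +_) (sum<-const k c)

∣-sum< : ∀ {d} k f → (∀ i → i < k → d ∣ f i) → d ∣ sum< k f
∣-sum< zero    f d∣f = _ ∣0
∣-sum< (suc k) f d∣f = ∣m∣n⇒∣m+n (d∣f 0 z<s) (∣-sum< k (f ∘ suc) (λ i i<k → d∣f (suc i) (s<s i<k)))

sum<-% : ∀ {n} .{{_ : NonZero n}} k f g → (∀ i → i < k → f i % n ≡ g i % n) → sum< k f % n ≡ sum< k g % n
sum<-% zero    f g f≡g = refl
sum<-% (suc k) f g f≡g = %-cong-+ (f≡g 0 z<s) (sum<-% k (f ∘ suc) (g ∘ suc) (λ i i<k → f≡g (suc i) (s<s i<k)))

binomial : ∀ n x → (1 + x) ^ n ≡ ∑[ j < suc n ] ((n C j) * x ^ j)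
binomial n x = begin
  (1 + x) ^ n                         ≡⟨ cong (_^ n) (+-comm 1 x) ⟩
  (x + 1) ^ n                         ≡⟨ ^≡^ (x + 1) n ⟨
  (x + 1) Semiring.^ n                ≡⟨ Binomial.theorem n x 1 ⟩
  binomialExpansion x 1 n             ≡⟨ sum≡sum< (suc n) term ⟩
  sum< (suc n) term                   ≡⟨ sum<-cong (suc n) term≡ ⟩
  ∑[ j < suc n ] ((n C j) * x ^ j)    ∎
  where
  open ≡-Reasoning
  ^≡^ : ∀ y k → y Semiring.^ k ≡ y ^ k
  ^≡^ y zero    = refl
  ^≡^ y (suc k) = cong (y *_) (^≡^ y k)
  ×≡* : ∀ k y → k Multiple.× y ≡ k * y
  ×≡* zero    y = refl
  ×≡* (suc k) y = cong (y +_) (×≡* k y)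
  sum≡sum< : ∀ k (f : ℕ → ℕ) → Sum.sum (f ∘ toℕ {k}) ≡ sum< k f
  sum≡sum< zero    f = refl
  sum≡sum< (suc k) f = cong (f 0 +_) (sum≡sum< k (f ∘ suc))
  term : ℕ → ℕ
  term j = (n C j) Multiple.× (x Semiring.^ j * 1 Semiring.^ (n ∸ j))
  term≡ : ∀ j → term j ≡ (n C j) * x ^ j
  term≡ j = begin
    term j                                          ≡⟨ ×≡* (n C j) _ ⟩
    (n C j) * (x Semiring.^ j * 1 Semiring.^ (n ∸ j))
      ≡⟨ cong₂ (λ a b → (n C j) * (a * b)) (^≡^ x j) (trans (^≡^ 1 (n ∸ j)) (^-zeroˡ (n ∸ j))) ⟩
    (n C j) * (x ^ j * 1)                             ≡⟨ cong ((n C j) *_) (*-identityʳ (x ^ j)) ⟩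
    (n C j) * x ^ j                                   ∎

sumPowers : ℕ → ℕ → ℕ
sumPowers q j = ∑[ x < q ] (x ^ j)

-- Summing the binomial expansion of (1 + x) ^ (k + 1) over x < q telescopes.
binomial-sumPowers : ∀ q k → ∑[ j < suc k ] ((suc k C j) * sumPowers q j) ≡ q ^ suc k
binomial-sumPowers q k = +-cancelʳ-≡ (sumPowers q (suc k)) _ _ (begin
  ∑[ j < suc k ] ((suc k C j) * sumPowers q j) + sumPowers q (suc k)
    ≡⟨ cong (lower +_) (*-identityˡ (sumPowers q (suc k))) ⟨
  lower + 1 * sumPowers q (suc k)
    ≡⟨ cong (λ c → lower + c * sumPowers q (suc k)) (nCn≡1 (suc k)) ⟨
  lower + (suc k C suc k) * sumPowers q (suc k)
    ≡⟨ sum<-snoc (suc k) (λ j → (suc k C j) * sumPowers q j) ⟨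
  ∑[ j < suc (suc k) ] ((suc k C j) * sumPowers q j)
    ≡⟨ sum<-cong (suc (suc k)) (λ j → sum<-*ˡ q (suc k C j) (_^ j)) ⟨
  ∑[ j < suc (suc k) ] ∑[ x < q ] ((suc k C j) * x ^ j)
    ≡⟨ sum<-comm (suc (suc k)) q (λ j x → (suc k C j) * x ^ j) ⟩
  ∑[ x < q ] ∑[ j < suc (suc k) ] ((suc k C j) * x ^ j)
    ≡⟨ sum<-cong q (λ x → binomial (suc k) x) ⟨
  ∑[ x < q ] (suc x ^ suc k)
    ≡⟨ +-identityʳ _ ⟨
  ∑[ x < q ] (suc x ^ suc k) + 0
    ≡⟨ sum<-telescope q (_^ suc k) ⟩
  sumPowers q (suc k) + q ^ suc k
    ≡⟨ +-comm (sumPowers q (suc k)) _ ⟩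
  q ^ suc k + sumPowers q (suc k) ∎)
  where
  open ≡-Reasoning
  lower = ∑[ j < suc k ] ((suc k C j) * sumPowers q j)

-- In binomial-sumPowers q k the lower terms are divisible by q by induction,
-- leaving q ∣ (k + 1) * sumPowers q k with q ∤ k + 1.
prime∣sumPowers : ∀ {q} → Prime q → ∀ k → suc k < q → q ∣ sumPowers q k
prime∣sumPowers {q} q-prime = <-rec (λ k → suc k < q → q ∣ sumPowers q k) step
  where
  step : ∀ k → (∀ {j} → j < k → suc j < q → q ∣ sumPowers q j) → suc k < q → q ∣ sumPowers q k
  step k IH 1+k<q with euclidsLemma (suc k) (sumPowers q k) q-prime q∣[1+k]*Sₖ
    where
    lower = ∑[ j < k ] ((suc k C j) * sumPowers q j)
    [1+k]Ck≡1+k : suc k C k ≡ suc k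
    [1+k]Ck≡1+k = trans (nCk≡nC[n∸k] (n≤1+n k)) (trans (cong (suc k C_) (m+n∸n≡m 1 k)) (nC1≡n (suc k)))
    lower+[1+k]Sₖ≡qᵏ⁺¹ : lower + suc k * sumPowers q k ≡ q ^ suc k
    lower+[1+k]Sₖ≡qᵏ⁺¹ = begin
      lower + suc k * sumPowers q k               ≡⟨ cong (λ c → lower + c * sumPowers q k) [1+k]Ck≡1+k ⟨
      lower + (suc k C k) * sumPowers q k         ≡⟨ sum<-snoc k (λ j → (suc k C j) * sumPowers q j) ⟨
      ∑[ j < suc k ] ((suc k C j) * sumPowers q j) ≡⟨ binomial-sumPowers q k ⟩
      q ^ suc k                                   ∎
      where open ≡-Reasoning
    q∣lower : q ∣ lower
    q∣lower = ∣-sum< k _ (λ j j<k → ∣n⇒∣m*n (suc k C j) (IH j<k (<-trans (s<s j<k) 1+k<q)))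
    q∣[1+k]*Sₖ : q ∣ suc k * sumPowers q k
    q∣[1+k]*Sₖ = ∣m+n∣m⇒∣n (subst (q ∣_) (sym lower+[1+k]Sₖ≡qᵏ⁺¹) (m∣m*n (q ^ k))) q∣lower
  ... | inj₁ q∣1+k = contradiction (∣⇒≤ q∣1+k) (<⇒≱ 1+k<q)
  ... | inj₂ q∣Sₖ  = q∣Sₖ

-- If r = e mod (q ∸ 1) were positive, then x ^ r ≡ 1 for every unit x, so that
-- sumPowers q r ≡ q ∸ 1, contradicting prime∣sumPowers.
xᵉ≡1⇒[q∸1]∣e : ∀ {q e} .{{_ : NonZero q}} → Prime q →
               (∀ x → 0 < x → x < q → x ^ e % q ≡ 1 % q) → q ∸ 1 ∣ e
xᵉ≡1⇒[q∸1]∣e {q@(suc (suc q-2))} {e} q-prime xᵉ≡1 with e % suc q-2 in e%[q∸1]≡r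
... | zero   = m%n≡0⇒n∣m e (suc q-2) e%[q∸1]≡r
... | suc r' = contradiction q∸1≡0 λ ()
  where
  r = suc r'
  t = e / suc q-2
  e≡r+[q∸1]t : e ≡ r + suc q-2 * t
  e≡r+[q∸1]t = trans (m≡m%n+[m/n]*n e (suc q-2)) (cong₂ _+_ e%[q∸1]≡r (*-comm t (suc q-2)))
  xʳ≡1 : ∀ x → 0 < x → x < q → x ^ r % q ≡ 1 % q
  xʳ≡1 x 0<x x<q = begin
    x ^ r % q                        ≡⟨ cong (_% q) (*-identityʳ (x ^ r)) ⟨
    x ^ r * 1 % q                    ≡⟨ cong (λ y → x ^ r * y % q) (^-zeroˡ t) ⟨
    x ^ r * 1 ^ t % q                ≡⟨ %-cong-*ˡ (x ^ r) (%-cong-^ t (fermat q-prime q∤x)) ⟨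
    x ^ r * (x ^ suc q-2) ^ t % q    ≡⟨ cong (λ y → x ^ r * y % q) (^-*-assoc x (suc q-2) t) ⟩
    x ^ r * x ^ (suc q-2 * t) % q    ≡⟨ cong (_% q) (^-distribˡ-+-* x r _) ⟨
    x ^ (r + suc q-2 * t) % q        ≡⟨ cong (λ i → x ^ i % q) e≡r+[q∸1]t ⟨
    x ^ e % q                        ≡⟨ xᵉ≡1 x 0<x x<q ⟩
    1 % q                            ∎
    where
    open ≡-Reasoning
    q∤x : ¬ q ∣ x
    q∤x q∣x = <⇒≱ x<q (∣⇒≤ {{>-nonZero 0<x}} q∣x)
  Sᵣ≡q∸1 : sumPowers q r % q ≡ suc q-2 % q
  Sᵣ≡q∸1 = trans (sum<-% (suc q-2) (λ x → suc x ^ r) (λ _ → 1) (λ i i<q∸1 → xʳ≡1 (suc i) z<s (s<s i<q∸1)))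
                 (cong (_% q) (trans (sum<-const (suc q-2) 1) (*-identityʳ (suc q-2))))
  r<q∸1 : r < suc q-2
  r<q∸1 = subst (_< suc q-2) e%[q∸1]≡r (m%n<n e (suc q-2))
  q∸1≡0 : suc q-2 ≡ 0
  q∸1≡0 = begin
    suc q-2            ≡⟨ m<n⇒m%n≡m (n<1+n (suc q-2)) ⟨
    suc q-2 % q        ≡⟨ Sᵣ≡q∸1 ⟨
    sumPowers q r % q  ≡⟨ n∣m⇒m%n≡0 _ q (prime∣sumPowers q-prime r (s<s r<q∸1)) ⟩
    0                  ∎
    where open ≡-Reasoning

-- Prime factors of squarefree numbers and of their totients

prime-divisor : ∀ {n} → 1 < n → ∃[ p ] Prime p × p ∣ n
prime-divisor {n} 1<n with factorise n {{>-nonZero (<-trans z<s 1<n)}}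
... | record { factors = [] ; isFactorisation = n≡1 } = contradiction n≡1 (>⇒≢ 1<n)
... | record { factors = p ∷ ps ; isFactorisation = n≡p*ps ; factorsPrime = p-prime All.∷ _ } =
  p , p-prime , divides (product ps) (trans n≡p*ps (*-comm p (product ps)))

squareFree-∣ : ∀ {m n} → m ∣ n → SquareFree n → SquareFree m
squareFree-∣ m∣n sf d d*d∣m = sf d (∣-trans d*d∣m m∣n)

squareFree⇒prime∤cofactor : ∀ {m q} → SquareFree (m * q) → Prime q → ¬ q ∣ m
squareFree⇒prime∤cofactor {m} {q} sf q-prime (divides t m≡tq) =
  nonTrivial⇒≢1 {{prime⇒nonTrivial q-prime}} (sf q (divides t (trans (cong (_* q) m≡tq) (*-assoc t q q))))

¬squareFree[0] : ¬ SquareFree 0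
¬squareFree[0] sf = contradiction (sf 2 (4 ∣0)) λ ()

prime∣φ[q*m] : ∀ {p q m} → Prime p → Prime q → ¬ q ∣ m → p ∣ φ (q * m) → p ∣ q ∸ 1 ⊎ p ∣ φ m
prime∣φ[q*m] {p} {q} {m} p-prime q-prime q∤m p∣φ =
  euclidsLemma (q ∸ 1) (φ m) p-prime (subst (p ∣_) (φ[q*m]≡[q∸1]*φ[m] q-prime q∤m) p∣φ)

-- For squarefree n = q₁ ⋯ qₖ, φ n = (q₁ ∸ 1) ⋯ (qₖ ∸ 1).
prime∣φ⇒prime∣[q∸1] : ∀ {n p} → SquareFree n → Prime p → p ∣ φ n → ∃[ q ] Prime q × q ∣ n × p ∣ q ∸ 1
prime∣φ⇒prime∣[q∸1] {n} {p} sf p-prime = <-rec Goal step n sf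
  where
  Goal : ℕ → Set
  Goal n = SquareFree n → p ∣ φ n → ∃[ q ] Prime q × q ∣ n × p ∣ q ∸ 1
  step : ∀ n → (∀ {m} → m < n → Goal m) → Goal n
  step zero            IH sf p∣φ = contradiction sf ¬squareFree[0]
  step (suc zero)      IH sf p∣φ = contradiction p∣φ (prime∤1 p-prime)
  step n@(suc (suc _)) IH sf p∣φ with prime-divisor {n} (s<s z<s)
  ... | q , q-prime , divides zero ()
  ... | q , q-prime , q∣n@(divides m@(suc _) n≡mq) =
    [ (λ p∣q∸1 → q , q-prime , q∣n , p∣q∸1) , from-cofactor ]′ (prime∣φ[q*m] p-prime q-prime q∤m p∣φ[qm])
    where
    n≡qm : n ≡ q * m
    n≡qm = trans n≡mq (*-comm m q)
    q∤m : ¬ q ∣ m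
    q∤m = squareFree⇒prime∤cofactor (subst SquareFree n≡mq sf) q-prime
    p∣φ[qm] : p ∣ φ (q * m)
    p∣φ[qm] = subst (λ k → p ∣ φ k) n≡qm p∣φ
    m∣n : m ∣ n
    m∣n = divides q n≡qm
    m<n : m < n
    m<n = subst (m <_) (sym n≡mq) (m<m*n m q (nonTrivial⇒n>1 q {{prime⇒nonTrivial q-prime}}))
    from-cofactor : p ∣ φ m → ∃[ q' ] Prime q' × q' ∣ n × p ∣ q' ∸ 1
    from-cofactor p∣φ[m] with IH m<n (squareFree-∣ m∣n sf) p∣φ[m]
    ... | q' , q'-prime , q'∣m , p∣q'∸1 = q' , q'-prime , ∣-trans q'∣m m∣n , p∣q'∸1

coprime-1+nilpotent : ∀ {n u} → n ∣ u * u → Coprime (1 + u) n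
coprime-1+nilpotent {n} {u} n∣u² {c} (c∣1+u , c∣n) = ∣1⇒≡1 (∣1+n∣n⇒∣1 c∣1+u c∣u)
  where
  c⊥u : Coprime c u
  c⊥u (d∣c , d∣u) = ∣1⇒≡1 (∣1+n∣n⇒∣1 (∣-trans d∣c c∣1+u) d∣u)
  c∣u : c ∣ u
  c∣u = coprime-divisor c⊥u (∣-trans c∣n n∣u²)

[1+u]^k≡1+k*u : ∀ {n u} .{{_ : NonZero n}} → n ∣ u * u → ∀ k → (1 + u) ^ k % n ≡ (1 + k * u) % n
[1+u]^k≡1+k*u         n∣u² zero    = refl
[1+u]^k≡1+k*u {n} {u} n∣u² (suc k) = begin
  (1 + u) * (1 + u) ^ k % n            ≡⟨ %-cong-*ˡ (1 + u) ([1+u]^k≡1+k*u n∣u² k) ⟩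
  (1 + u) * (1 + k * u) % n            ≡⟨ cong (_% n) (solve 2 (λ u k → (con 1 :+ u) :* (con 1 :+ k :* u)
                                            := con 1 :+ (con 1 :+ k) :* u :+ k :* (u :* u)) refl u k) ⟩
  (1 + suc k * u + k * (u * u)) % n    ≡⟨ %-remove-+ʳ (1 + suc k * u) (∣n⇒∣m*n k n∣u²) ⟩
  (1 + suc k * u) % n                  ∎
  where open ≡-Reasoning

-- If d * d ∣ n then u = n / d satisfies n ∣ u * u, and (1 + u) ^ (n ∸ 1) ≡ 1 forces d ∣ n ∸ 1.
carmichael⇒squareFree : ∀ {n} .{{_ : NonZero n}} → (∀ a → Coprime a n → a ^ (n ∸ 1) % n ≡ 1 % n) → SquareFree n
carmichael⇒squareFree {n} car zero              d²∣n = contradiction (0∣⇒≡0 d²∣n) (≢-nonZero⁻¹ n)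
carmichael⇒squareFree {n} car (suc zero)        d²∣n = refl
carmichael⇒squareFree {n} car d@(suc (suc _)) (divides zero n≡0) = contradiction n≡0 (≢-nonZero⁻¹ n)
carmichael⇒squareFree {n} car d@(suc (suc _)) (divides t@(suc _) n≡t*d²) = ∣1⇒≡1 (∣1+n∣n⇒∣1 d∣1+[n∸1] d∣n∸1)
  where
  u = d * t
  n≡d*u : n ≡ d * u
  n≡d*u = trans n≡t*d² (solve 2 (λ t d → t :* (d :* d) := d :* (d :* t)) refl t d)
  n∣u² : n ∣ u * u
  n∣u² = divides t (trans (solve 2 (λ d t → d :* t :* (d :* t) := t :* (d :* (d :* t))) refl d t) (cong (t *_) (sym n≡d*u)))
  1+[n∸1]u≡1 : (1 + (n ∸ 1) * u) % n ≡ 1 % n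
  1+[n∸1]u≡1 = trans (sym ([1+u]^k≡1+k*u n∣u² (n ∸ 1))) (car (1 + u) (coprime-1+nilpotent n∣u²))
  d∣n∸1 : d ∣ n ∸ 1
  d∣n∸1 = *-cancelʳ-∣ u (subst (_∣ (n ∸ 1) * u) n≡d*u (%≡%⇒∣∸ 1+[n∸1]u≡1))
  d∣1+[n∸1] : d ∣ 1 + (n ∸ 1)
  d∣1+[n∸1] = divides u (trans (m+[n∸m]≡n (>-nonZero⁻¹ n)) (trans n≡d*u (*-comm d u)))

carmichael⇒powerSum≡φ : ∀ e .{{_ : NonZero e}} → (∀ a → Coprime a (suc e) → a ^ e % suc e ≡ 1 % suc e) →
                        powerSum (suc e) % suc e ≡ φ (suc e) % suc e
carmichael⇒powerSum≡φ e car = begin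
  sum (map (_^ e) (units n)) % n
    ≡⟨ sum-map-% (_^ e) (λ _ → 1) (units n) (λ x∈ → car _ (proj₂ (proj₂ (∈-units⁻ e x∈)))) ⟩
  sum (map (λ _ → 1) (units n)) % n       ≡⟨ cong (_% n) (trans (sum-map-1 (units n)) (length-units e)) ⟩
  φ n % n                                 ∎
  where
  open ≡-Reasoning
  n = suc e

-- The witness a = x * m ^ (q ∸ 1) + q is ≡ x modulo q (Fermat) and ≡ q modulo every divisor of m.
lift-unit : ∀ {q m x} .{{_ : NonZero q}} → Prime q → Coprime q m → ¬ q ∣ x →
            ∃[ a ] Coprime a (q * m) × a % q ≡ x % q
lift-unit {q@(suc (suc q-2))} {m} {x} q-prime q⊥m q∤x = a , coprime-*ʳ a⊥q a⊥m , a≡x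
  where
  a = x * m ^ suc q-2 + q
  a≡x : a % q ≡ x % q
  a≡x = begin
    (x * m ^ suc q-2 + q) % q  ≡⟨ [m+n]%n≡m%n (x * m ^ suc q-2) q ⟩
    x * m ^ suc q-2 % q        ≡⟨ %-cong-*ˡ x (fermat q-prime (coprime⇒prime∤ q-prime q⊥m)) ⟩
    x * 1 % q                  ≡⟨ cong (_% q) (*-identityʳ x) ⟩
    x % q                      ∎
    where open ≡-Reasoning
  a⊥q : Coprime a q
  a⊥q = coprime-sym (prime∤⇒coprime q-prime λ q∣a → q∤x (m%n≡0⇒n∣m x q (trans (sym a≡x) (n∣m⇒m%n≡0 a q q∣a))))
  a⊥m : Coprime a m
  a⊥m {d} (d∣a , d∣m) = q⊥m (∣m+n∣m⇒∣n d∣a (∣n⇒∣m*n x (∣m⇒∣m*n (m ^ q-2) d∣m)) , d∣m)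

module _ (e : ℕ) .{{_ : NonZero e}} where
  private
    n = suc e

  UnitPowersFixφ : Set
  UnitPowersFixφ = ∀ a → Coprime a n → a ^ e * φ n % n ≡ φ n % n

  powerSum≡φ⇒unitPowersFixφ : powerSum n % n ≡ φ n % n → UnitPowersFixφ
  powerSum≡φ⇒unitPowersFixφ S≡φ a a⊥n = begin
    a ^ e * φ n % n          ≡⟨ %-cong-*ˡ (a ^ e) S≡φ ⟨
    a ^ e * powerSum n % n   ≡⟨ units-power-sum-invariant e e a⊥n ⟩
    powerSum n % n           ≡⟨ S≡φ ⟩
    φ n % n                  ∎
    where open ≡-Reasoning

  module _ (sf : SquareFree n) (fix : UnitPowersFixφ) where

    prime∤φ⇒[q∸1]∣e : ∀ {q} → Prime q → q ∣ n → ¬ q ∣ φ n → q ∸ 1 ∣ e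
    prime∤φ⇒[q∸1]∣e {q} q-prime q∣n@(divides m n≡mq) q∤φ = xᵉ≡1⇒[q∸1]∣e q-prime xᵉ≡1
      where
      instance _ = prime⇒nonZero q-prime
      n≡qm : n ≡ q * m
      n≡qm = trans n≡mq (*-comm m q)
      q⊥m : Coprime q m
      q⊥m = prime∤⇒coprime q-prime (squareFree⇒prime∤cofactor (subst SquareFree n≡mq sf) q-prime)
      xᵉ≡1 : ∀ x → 0 < x → x < q → x ^ e % q ≡ 1 % q
      xᵉ≡1 x 0<x x<q with lift-unit q-prime q⊥m (λ q∣x → <⇒≱ x<q (∣⇒≤ {{>-nonZero 0<x}} q∣x))
      ... | a , a⊥qm , a≡x = begin
        x ^ e % q      ≡⟨ %-cong-^ {q} {a} {x} e a≡x ⟨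
        a ^ e % q      ≡⟨ %≡%-cancelʳ {a = a ^ e} {1} (coprime-sym (prime∤⇒coprime q-prime q∤φ)) aᵉφ≡φ ⟩
        1 % q          ∎
        where
        open ≡-Reasoning
        aᵉφ≡φ : a ^ e * φ n % q ≡ 1 * φ n % q
        aᵉφ≡φ = trans (%≡%-∣ q∣n (fix a (subst (Coprime a) (sym n≡qm) a⊥qm))) (cong (_% q) (sym (*-identityˡ (φ n))))

    -- p ∣ q ∸ 1 for a prime q ∣ n; then q ∣ φ n, since otherwise p ∣ q ∸ 1 ∣ e while p ∣ 1 + e.
    -- So q is a larger prime with the same property, and k bounds how often this can repeat.
    prime∣n⇒prime∤φ : ∀ k {p} → n ≤ p + k → Prime p → p ∣ n → ¬ p ∣ φ n
    prime∣n⇒prime∤φ k {p} n≤p+k p-prime p∣n p∣φ with prime∣φ⇒prime∣[q∸1] sf p-prime p∣φ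
    ... | q , q-prime , q∣n , p∣q∸1 with q ∣? φ n
    ...   | no q∤φ = prime∤1 p-prime (∣1+n∣n⇒∣1 p∣n (∣-trans p∣q∸1 (prime∤φ⇒[q∸1]∣e q-prime q∣n q∤φ)))
    ...   | yes q∣φ = ascend k n≤p+k
      where
      1<q = nonTrivial⇒n>1 q {{prime⇒nonTrivial q-prime}}
      p<q : p < q
      p<q = ≤-<-trans (∣⇒≤ {{>-nonZero (m<n⇒0<n∸m 1<q)}} p∣q∸1) (∸-monoʳ-< z<s (<⇒≤ 1<q))
      ascend : ∀ k → n ≤ p + k → ⊥
      ascend zero    n≤p   = <⇒≱ (<-≤-trans p<q (∣⇒≤ q∣n)) (subst (n ≤_) (+-identityʳ p) n≤p)
      ascend (suc k) n≤p+1+k = prime∣n⇒prime∤φ k n≤q+k q-prime q∣n q∣φ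
        where
        n≤q+k : n ≤ q + k
        n≤q+k = ≤-trans n≤p+1+k (subst (_≤ q + k) (sym (+-suc p k)) (+-monoˡ-≤ k p<q))

    coprime[φ,n] : Coprime (φ n) n
    coprime[φ,n] {zero}          (_ , 0∣n) = contradiction (0∣⇒≡0 0∣n) λ ()
    coprime[φ,n] {suc zero}      _         = refl
    coprime[φ,n] {d@(suc (suc _))} (d∣φ , d∣n) with prime-divisor {d} (s<s z<s)
    ... | p , p-prime , p∣d =
      contradiction (∣-trans p∣d d∣φ) (prime∣n⇒prime∤φ n (m≤n+m n p) p-prime (∣-trans p∣d d∣n))

    unitPowersFixφ⇒carmichael : ∀ {a} → Coprime a n → a ^ e % n ≡ 1 % n
    unitPowersFixφ⇒carmichael {a} a⊥n =
      %≡%-cancelʳ {a = a ^ e} {1} coprime[φ,n] (trans (fix a a⊥n) (cong (_% n) (sym (*-identityˡ (φ n)))))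

corollary2p16 : (n : ℕ) → Composite n →
    (Carmichael n ⇔ (SquareFree n × powerSum n ≡ φ n [mod n ]))
corollary2p16 zero                n-composite = contradiction n-composite ¬composite[0]
corollary2p16 (suc zero)          n-composite = contradiction n-composite ¬composite[1]
corollary2p16 n@(suc e@(suc _)) n-composite = mk⇔ to from
  where
  to : Carmichael n → SquareFree n × powerSum n ≡ φ n [mod n ]
  to (_ , carmichael) = carmichael⇒squareFree car , %≡%⇒≡[mod] (carmichael⇒powerSum≡φ e car)
    where
    car : ∀ a → Coprime a n → a ^ e % n ≡ 1 % n
    car a a⊥n = ≡[mod]⇒%≡% (carmichael a a⊥n)
  from : SquareFree n × powerSum n ≡ φ n [mod n ] → Carmichael n
  from (sf , S≡φ) = n-composite , λ a a⊥n →
    %≡%⇒≡[mod] (unitPowersFixφ⇒carmichael e sf (powerSum≡φ⇒unitPowersFixφ e (≡[mod]⇒%≡% S≡φ)) a⊥n)
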